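{- There is a unimodal frame $C=(X,R)$ that is a cluster (i.e., $(a,b)\in R^*$ for all $a,b\in X$) such that $R$ satisfies $\mathrm{RP}_2$, while the logic of $C$ is not locally tabular.
   Context: $R^*$ is the reflexive transitive closure of $R$. For $m<\omega$, $\mathrm{RP}_m$ is the property: for all $x_0,\dots,x_{m+1}$, if $x_0Rx_1R\cdots Rx_{m+1}$ then $x_i=x_j$ for some $i<j\le m+1$ or $x_iRx_{j+1}$ for some $i<j\le m$. The logic of a frame is the set of modal formulas valid in it; a logic is locally tabular if for every finite $k$ it has only finitely many pairwise nonequivalent formulas in $k$ variables. -}

module Defs where

open import Data.Nat using (ℕ; zero; suc)
open import Data.Fin using (Fin; inject₁) renaming (suc to fsuc; _<_ to _<ᶠ_)
open import Data.Product using (Σ; _×_; _,_)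
open import Data.Sum using (_⊎_)
open import Data.Empty using (⊥)
open import Data.List using (List)
open import Data.List.Relation.Unary.Any using (Any)
open import Relation.Nullary using (¬_)
open import Relation.Binary.PropositionalEquality using (_≡_)
open import Relation.Binary.Construct.Closure.ReflexiveTransitive using (Star)

record Frame : Set₁ where
  field
    X : Set
    R : X → X → Set

open Frame public

IsCluster : Frame → Set
IsCluster C = ∀ (a b : X C) → Star (R C) a b

-- RP_m: for all x_0 R x_1 R ... R x_{m+1}, either x_i = x_j for some
-- i < j ≤ m+1, or x_i R x_{j+1} for some i < j ≤ m.
RP : ℕ → Frame → Set
RP m C =
  (x : Fin (suc (suc m)) → X C) →
  (∀ (i : Fin (suc m)) → R C (x (inject₁ i)) (x (fsuc i))) →
  (Σ (Fin (suc (suc m))) λ i → Σ (Fin (suc (suc m))) λ j → i <ᶠ j × x i ≡ x j)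
  ⊎ (Σ (Fin (suc m)) λ i → Σ (Fin (suc m)) λ j →
       i <ᶠ j × R C (x (inject₁ i)) (x (fsuc j)))

data Fm (k : ℕ) : Set where
  var  : Fin k → Fm k
  ⊥'   : Fm k
  _⇒_  : Fm k → Fm k → Fm k
  □_   : Fm k → Fm k

infixr 5 _⇒_
infix 7 □_

¬'_ : ∀ {k} → Fm k → Fm k
¬' φ = φ ⇒ ⊥'

_∧'_ : ∀ {k} → Fm k → Fm k → Fm k
φ ∧' ψ = ¬' (φ ⇒ ¬' ψ)

_⇔_ : ∀ {k} → Fm k → Fm k → Fm k
φ ⇔ ψ = (φ ⇒ ψ) ∧' (ψ ⇒ φ)

-- Classical Kripke semantics, rendered constructively via the
-- Goedel-Gentzen (double negation) reading of atoms; all clauses are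
-- ¬¬-stable, so this coincides with classical truth.
Sat : ∀ {k} (C : Frame) → (Fin k → X C → Set) → X C → Fm k → Set
Sat C V x (var p) = ¬ ¬ V p x
Sat C V x ⊥'      = ⊥
Sat C V x (φ ⇒ ψ) = Sat C V x φ → Sat C V x ψ
Sat C V x (□ φ)   = ∀ y → R C x y → Sat C V y φ

Valid : ∀ {k} → Frame → Fm k → Set₁
Valid {k} C φ = ∀ (V : Fin k → X C → Set) (x : X C) → Sat C V x φ

LocallyTabular : Frame → Set₁
LocallyTabular C =
  ∀ (k : ℕ) → Σ (List (Fm k)) λ fs →
    ∀ (φ : Fm k) → Any (λ ψ → Valid C (φ ⇔ ψ)) fs

-- The frame is ℕ where every point sees 0 and every larger number. Since all points see 0
-- and 0 sees everything, it is a cluster; in a chain x₀ R x₁ R x₂ R x₃ either a zero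
-- gives a shortcut, or the chain is strictly increasing and R is transitive on it, so
-- RP₂ holds. Making p true exactly on {1, …, m}, the p-steps go strictly upwards inside
-- {1, …, m}, so from 0 there are p-chains of length m but not m + 1. Hence the formulas
-- γₙ = □(p → γₙ₋₁), γ₀ = ⊥ (noChain n), are pairwise inequivalent: γₘ fails and γₙ holds
-- at 0 for m < n. Infinitely many inequivalent one-variable formulas refute local tabularity.
module Submission where

open import Defs
open import Data.Empty using (⊥; ⊥-elim)
open import Data.Fin using (Fin; toℕ) renaming (zero to fzero; suc to fsuc)
open import Data.Fin.Properties using (pigeonhole)
open import Data.List using (length; lookup)
open import Data.List.Relation.Unary.Any using (index)
open import Data.List.Relation.Unary.Any.Properties using (lookup-index)
open import Data.Nat using (ℕ; zero; suc; _<_; _≤_; _∸_; _≟_; _<?_; _≤?_; z≤n; s≤s)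
open import Data.Nat.Properties
  using (n≢0⇒n>0; n>0⇒n≢0; <-trans; <-≤-trans; ∸-monoʳ-<; m∸n≢0⇒n<m; pred-mono-≤;
         pred[m∸n]≡m∸[1+n]; n<1+n; ≤-refl)
open import Data.Product using (Σ; _×_; _,_)
open import Data.Sum using (_⊎_; inj₁; inj₂)
open import Relation.Binary.Construct.Closure.ReflexiveTransitive using (ε; _◅_)
open import Relation.Binary.PropositionalEquality using (_≡_; _≢_; refl; sym; subst)
open import Relation.Nullary using (¬_; yes; no)
open import Relation.Nullary.Decidable using (decidable-stable; _×-dec_)

private
  variable
    k : ℕ
    C : Frame

inequivalent-to-same : ∀ {V : Fin k → X C → Set} {x} {φ χ ψ : Fm k} →
  Sat C V x φ → ¬ Sat C V x χ → Valid C (φ ⇔ ψ) → Valid C (χ ⇔ ψ) → ⊥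
inequivalent-to-same {V = V} {x} sφ ¬sχ φ⇔ψ χ⇔ψ =
  φ⇔ψ V x λ φ⇒ψ _ → χ⇔ψ V x λ _ ψ⇒χ → ¬sχ (ψ⇒χ (φ⇒ψ sφ))

Separates : (C : Frame) → Fm k → Fm k → Set₁
Separates {k} C φ χ =
  Σ (Fin k → X C → Set) λ V → Σ (X C) λ x → Sat C V x φ × ¬ Sat C V x χ

separated-sequence⇒¬LocallyTabular : (φ : ℕ → Fm k) →
  (∀ {m n} → m < n → Separates C (φ n) (φ m)) → ¬ LocallyTabular C
separated-sequence⇒¬LocallyTabular {k} {C} φ separated locallyTabular
  with fs , equivalent ← locallyTabular k
  with i , j , i<j , same ←
    pigeonhole (n<1+n (length fs)) (λ n → index (equivalent (φ (toℕ n))))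
  with V , x , sφⱼ , ¬sφᵢ ← separated i<j =
  inequivalent-to-same sφⱼ ¬sφᵢ
    (subst (λ l → Valid C (φ (toℕ j) ⇔ lookup fs l)) (sym same)
      (lookup-index (equivalent (φ (toℕ j)))))
    (lookup-index (equivalent (φ (toℕ i))))

_↝_ : ℕ → ℕ → Set
x ↝ y = y ≡ 0 ⊎ x < y

resetFrame : Frame
resetFrame = record { X = ℕ ; R = _↝_ }

↝-nonzero⇒< : ∀ {x y} → x ↝ y → y ≢ 0 → x < y
↝-nonzero⇒< (inj₁ y≡0) y≢0 = ⊥-elim (y≢0 y≡0)
↝-nonzero⇒< (inj₂ x<y) _   = x<y

resetFrame-isCluster : IsCluster resetFrame
resetFrame-isCluster a zero    = inj₁ refl ◅ ε
resetFrame-isCluster a (suc b) = inj₁ refl ◅ inj₂ (s≤s z≤n) ◅ ε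

resetFrame-RP₂ : RP 2 resetFrame
resetFrame-RP₂ x step
  with x (fsuc (fsuc fzero)) ≟ 0 | x (fsuc (fsuc (fsuc fzero))) ≟ 0 | x (fsuc fzero) ≟ 0
... | yes x₂≡0 | _         | _        = inj₂ (fzero , fsuc fzero , s≤s z≤n , inj₁ x₂≡0)
... | no _     | yes x₃≡0  | _        = inj₂ (fzero , fsuc (fsuc fzero) , s≤s z≤n , inj₁ x₃≡0)
... | no _     | no x₃≢0   | yes x₁≡0 =
  inj₂ (fsuc fzero , fsuc (fsuc fzero) , s≤s (s≤s z≤n) ,
        inj₂ (subst (_< x (fsuc (fsuc (fsuc fzero)))) (sym x₁≡0) (n≢0⇒n>0 x₃≢0)))
... | no x₂≢0  | no _      | no x₁≢0  =
  inj₂ (fzero , fsuc fzero , s≤s z≤n ,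
        inj₂ (<-trans (↝-nonzero⇒< (step fzero) x₁≢0) (↝-nonzero⇒< (step (fsuc fzero)) x₂≢0)))

noChain : ℕ → Fm 1
noChain zero    = ⊥'
noChain (suc n) = □ (var fzero ⇒ noChain n)

upTo : ℕ → Fin 1 → ℕ → Set
upTo m _ y = 0 < y × y ≤ m

upTo-stable : ∀ m y → ¬ ¬ upTo m fzero y → upTo m fzero y
upTo-stable m y = decidable-stable (0 <? y ×-dec y ≤? m)

noChain-holds : ∀ m n x → m ∸ x < n → Sat resetFrame (upTo m) x (noChain n)
noChain-holds m (suc n) x (s≤s m∸x≤n) y x↝y py
  with 0<y , y≤m ← upTo-stable m y py =
  noChain-holds m n y (<-≤-trans (∸-monoʳ-< (↝-nonzero⇒< x↝y (n>0⇒n≢0 0<y)) y≤m) m∸x≤n)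

noChain-fails : ∀ m n x → n ≤ m ∸ x → ¬ Sat resetFrame (upTo m) x (noChain n)
noChain-fails m zero    x _        sat = sat
noChain-fails m (suc n) x 1+n≤m∸x sat =
  noChain-fails m n (suc x) n≤m∸[1+x] (sat (suc x) (inj₂ ≤-refl) λ ¬p → ¬p (s≤s z≤n , x<m))
  where
  x<m : x < m
  x<m = m∸n≢0⇒n<m (n>0⇒n≢0 (<-≤-trans (s≤s z≤n) 1+n≤m∸x))
  n≤m∸[1+x] : n ≤ m ∸ suc x
  n≤m∸[1+x] = subst (n ≤_) (pred[m∸n]≡m∸[1+n] m x) (pred-mono-≤ 1+n≤m∸x)

noChain-separated : ∀ {m n} → m < n → Separates resetFrame (noChain n) (noChain m)
noChain-separated {m} {n} m<n =
  upTo m , 0 , noChain-holds m n 0 m<n , noChain-fails m m 0 ≤-refl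

proposition3p15 : Σ Frame λ C → IsCluster C × RP 2 C × ¬ LocallyTabular C
proposition3p15 =
  resetFrame , resetFrame-isCluster , resetFrame-RP₂ ,
  separated-sequence⇒¬LocallyTabular noChain noChain-separated
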